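{- For every integer $k \geq 1$, let $c(k)$ denote the greatest common divisor of all the integers $\sum_{i=1}^{k} c_{n+i}$ for $n \geq 0$. Then $$c(k) = \begin{cases} 4P_{k}, & \text{if } k \text{ is even};\\ Q_{k}, & \text{if } k \text{ is odd}.\end{cases}$$
   Context: The Lucas-cobalancing sequence $(c_n)_{n\ge 0}$ is defined by $c_0=-1$, $c_1=1$, $c_n=6c_{n-1}-c_{n-2}$ for $n\ge 2$. The Pell sequence $(P_n)_{n\ge 0}$ is defined by $P_0=0$, $P_1=1$, $P_n=2P_{n-1}+P_{n-2}$; the associated Pell sequence $(Q_n)_{n\ge 0}$ by $Q_0=1$, $Q_1=1$, $Q_n=2Q_{n-1}+Q_{n-2}$. -}

module Defs where

open import Data.Nat using (ℕ; zero; suc)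
open import Data.Integer using (ℤ; +_; -_; _+_; _-_; _*_)
open import Data.Integer.Divisibility using (_∣_)
open import Data.Product using (_×_)

c : ℕ → ℤ
c zero = - (+ 1)
c (suc zero) = + 1
c (suc (suc n)) = + 6 * c (suc n) - c n

P : ℕ → ℕ
P zero = 0
P (suc zero) = 1
P (suc (suc n)) = 2 Data.Nat.* P (suc n) Data.Nat.+ P n
  where import Data.Nat

Q : ℕ → ℕ
Q zero = 1
Q (suc zero) = 1
Q (suc (suc n)) = 2 Data.Nat.* Q (suc n) Data.Nat.+ Q n
  where import Data.Nat

sumC : ℕ → ℕ → ℤ
sumC n zero = + 0
sumC n (suc k) = sumC n k + c (n Data.Nat.+ suc k)
  where import Data.Nat

IsGCDOf : (ℕ → ℤ) → ℕ → Set
IsGCDOf f d = (∀ n → + d ∣ f n) × (∀ (e : ℤ) → (∀ n → e ∣ f n) → e ∣ + d)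

cGCD : ℕ → ℕ → Set
cGCD k d = IsGCDOf (λ n → sumC n k) d

-- For fixed k the sums s n = c (n+1) + ⋯ + c (n+k) satisfy s (n+2) = 6 s (n+1) − s n, so the gcd of
-- the whole family is gcd (s 0, s 1). With p = P k and q = Q k one has c (k+1) = 2p² + 4pq + q², which
-- is half the increment of q² + 2p² from k to k+1; hence 2 s 0 + 1 = q² + 2p². Together with the Pell
-- equation q² − 2p² = (−1)^k this gives s 0 = 4p · r and s 1 = 4p (3r + q) for even k, where p = 2r,
-- and s 0 = q · q and s 1 = q (3q + 4p) for odd k; in both cases the Pell equation also yields a
-- Bézout identity showing that the two cofactors are coprime.
module Submission where

open import Defs
open import Data.Nat as ℕ using (ℕ; zero; suc; _≥_)
open import Data.Nat.Divisibility using (_∣_; _∤_; divides; ∣m∣n⇒∣m+n; m∣m*n)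
open import Data.Product using (_×_; _,_; proj₁; proj₂; ∃-syntax)
open import Data.Sum using (_⊎_; inj₁; inj₂)
open import Data.List using (_∷_; [])
open import Data.Integer using (ℤ; +_; -_; _+_; _-_; _*_; _^_; 1ℤ; -1ℤ)
open import Data.Integer.Properties
  using (pos-+; pos-*; -1*i≡-i; neg-involutive; *-cancelˡ-≡; *-assoc; *-distribʳ-+; *-identityˡ; +-assoc)
import Data.Integer.Divisibility as Unsigned
import Data.Integer.Divisibility.Signed as Signed
open import Data.Integer.Tactic.RingSolver using (solve; solve-∀)
import Data.Nat.Tactic.RingSolver as ℕ-Solver
open import Relation.Nullary using (contradiction)
open import Relation.Binary.PropositionalEquality
open ≡-Reasoning

Recurrence : ℤ → ℤ → (ℕ → ℤ) → Set
Recurrence a b f = ∀ n → f (suc (suc n)) ≡ a * f (suc n) + b * f n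

record GCDCertificate (m n d : ℤ) : Set where
  field
    x y α β : ℤ
    m≡x*d   : m ≡ x * d
    n≡y*d   : n ≡ y * d
    bézout  : α * x + β * y ≡ 1ℤ

module LinearRecurrence (a b : ℤ) where

  Recurrence-+ : ∀ {f g} → Recurrence a b f → Recurrence a b g →
                 Recurrence a b (λ n → f n + g n)
  Recurrence-+ {f} {g} rec-f rec-g n =
    trans (cong₂ _+_ (rec-f n) (rec-g n)) (distrib a b (f (suc n)) (f n) (g (suc n)) (g n))
    where
    distrib : ∀ a b x y u v →
              (a * x + b * y) + (a * u + b * v) ≡ a * (x + u) + b * (y + v)
    distrib = solve-∀

  Recurrence-shift : ∀ {f} → Recurrence a b f → ∀ m → Recurrence a b (λ n → f (n ℕ.+ m))
  Recurrence-shift rec m n = rec (n ℕ.+ m)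

  Recurrence-∣ : ∀ {f d} → Recurrence a b f → d Signed.∣ f 0 → d Signed.∣ f 1 →
                 ∀ n → d Signed.∣ f n
  Recurrence-∣ {f} {d} rec d∣f₀ d∣f₁ n = proj₁ (consecutive n)
    where
    consecutive : ∀ n → d Signed.∣ f n × d Signed.∣ f (suc n)
    consecutive zero    = d∣f₀ , d∣f₁
    consecutive (suc n) with consecutive n
    ... | d∣fₙ , d∣fₙ₊₁ = d∣fₙ₊₁ , subst (d Signed.∣_) (sym (rec n))
      (Signed.∣m∣n⇒∣m+n (Signed.∣n⇒∣m*n a d∣fₙ₊₁) (Signed.∣n⇒∣m*n b d∣fₙ))

  Recurrence-IsGCDOf : ∀ {f d} → Recurrence a b f → GCDCertificate (f 0) (f 1) (+ d) → IsGCDOf f d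
  Recurrence-IsGCDOf {f} {d} rec cert = divides-all , greatest
    where
    open GCDCertificate cert
    divides-all : ∀ n → + d Unsigned.∣ f n
    divides-all n = Signed.∣⇒∣ᵤ
      (Recurrence-∣ rec (Signed.divides x m≡x*d) (Signed.divides y n≡y*d) n)
    combination : α * f 0 + β * f 1 ≡ + d
    combination = begin
      α * f 0 + β * f 1               ≡⟨ cong₂ (λ u v → α * u + β * v) m≡x*d n≡y*d ⟩
      α * (x * + d) + β * (y * + d)   ≡⟨ cong₂ _+_ (sym (*-assoc α x (+ d))) (sym (*-assoc β y (+ d))) ⟩
      α * x * + d + β * y * + d       ≡⟨ *-distribʳ-+ (+ d) (α * x) (β * y) ⟨
      (α * x + β * y) * + d           ≡⟨ cong (_* + d) bézout ⟩
      1ℤ * + d                        ≡⟨ *-identityˡ (+ d) ⟩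
      + d                             ∎
    greatest : ∀ e → (∀ n → e Unsigned.∣ f n) → e Unsigned.∣ + d
    greatest e e∣f = Signed.∣⇒∣ᵤ (subst (e Signed.∣_) combination
      (Signed.∣m∣n⇒∣m+n (Signed.∣n⇒∣m*n α (Signed.∣ᵤ⇒∣ (e∣f 0)))
                        (Signed.∣n⇒∣m*n β (Signed.∣ᵤ⇒∣ (e∣f 1)))))

open LinearRecurrence (+ 6) -1ℤ

c-recurrence : Recurrence (+ 6) -1ℤ c
c-recurrence n = cong (λ t → + 6 * c (suc n) + t) (sym (-1*i≡-i (c n)))

sumC-recurrence : ∀ k → Recurrence (+ 6) -1ℤ (λ n → sumC n k)
sumC-recurrence zero    n = refl
sumC-recurrence (suc k)   =
  Recurrence-+ {λ n → sumC n k} (sumC-recurrence k) (Recurrence-shift {c} c-recurrence (suc k))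

P-suc : ∀ k → P (suc k) ≡ P k ℕ.+ Q k
P-suc zero          = refl
P-suc (suc zero)    = refl
P-suc (suc (suc k)) = begin
  2 ℕ.* P (suc (suc k)) ℕ.+ P (suc k)
    ≡⟨ cong₂ (λ u v → 2 ℕ.* u ℕ.+ v) (P-suc (suc k)) (P-suc k) ⟩
  2 ℕ.* (P (suc k) ℕ.+ Q (suc k)) ℕ.+ (P k ℕ.+ Q k)
    ≡⟨ interchange (P (suc k)) (Q (suc k)) (P k) (Q k) ⟩
  (2 ℕ.* P (suc k) ℕ.+ P k) ℕ.+ (2 ℕ.* Q (suc k) ℕ.+ Q k) ∎
  where
  interchange : ∀ a b c d → 2 ℕ.* (a ℕ.+ b) ℕ.+ (c ℕ.+ d) ≡ (2 ℕ.* a ℕ.+ c) ℕ.+ (2 ℕ.* b ℕ.+ d)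
  interchange = ℕ-Solver.solve-∀

Q-suc : ∀ k → Q (suc k) ≡ 2 ℕ.* P k ℕ.+ Q k
Q-suc zero          = refl
Q-suc (suc zero)    = refl
Q-suc (suc (suc k)) = begin
  2 ℕ.* Q (suc (suc k)) ℕ.+ Q (suc k)
    ≡⟨ cong₂ (λ u v → 2 ℕ.* u ℕ.+ v) (Q-suc (suc k)) (Q-suc k) ⟩
  2 ℕ.* (2 ℕ.* P (suc k) ℕ.+ Q (suc k)) ℕ.+ (2 ℕ.* P k ℕ.+ Q k)
    ≡⟨ interchange (P (suc k)) (Q (suc k)) (P k) (Q k) ⟩
  2 ℕ.* (2 ℕ.* P (suc k) ℕ.+ P k) ℕ.+ (2 ℕ.* Q (suc k) ℕ.+ Q k) ∎
  where
  interchange : ∀ a b c d →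
    2 ℕ.* (2 ℕ.* a ℕ.+ b) ℕ.+ (2 ℕ.* c ℕ.+ d) ≡ 2 ℕ.* (2 ℕ.* a ℕ.+ c) ℕ.+ (2 ℕ.* b ℕ.+ d)
  interchange = ℕ-Solver.solve-∀

P-even : ∀ m → 2 ∣ P (m ℕ.* 2)
P-even zero    = divides 0 refl
P-even (suc m) = ∣m∣n⇒∣m+n (m∣m*n (P (suc (m ℕ.* 2)))) (P-even m)

Pℤ Qℤ : ℕ → ℤ
Pℤ k = + P k
Qℤ k = + Q k

PQ-suc : ∀ (F : ℤ → ℤ → ℤ) k →
         F (Pℤ (suc k)) (Qℤ (suc k)) ≡ F (Pℤ k + Qℤ k) (+ 2 * Pℤ k + Qℤ k)
PQ-suc F k = cong₂ F
  (trans (cong +_ (P-suc k)) (pos-+ (P k) (Q k)))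
  (trans (cong +_ (Q-suc k))
         (trans (pos-+ (2 ℕ.* P k) (Q k)) (cong (_+ Qℤ k) (pos-* 2 (P k)))))

Pell-equation : ∀ k → Qℤ k * Qℤ k - + 2 * (Pℤ k * Pℤ k) ≡ -1ℤ ^ k
Pell-equation zero    = refl
Pell-equation (suc k) = begin
  Qℤ (suc k) * Qℤ (suc k) - + 2 * (Pℤ (suc k) * Pℤ (suc k))
    ≡⟨ PQ-suc (λ p q → q * q - + 2 * (p * p)) k ⟩
  (+ 2 * p + q) * (+ 2 * p + q) - + 2 * ((p + q) * (p + q))
    ≡⟨ step p q ⟩
  -1ℤ * (q * q - + 2 * (p * p))
    ≡⟨ cong (-1ℤ *_) (Pell-equation k) ⟩
  -1ℤ ^ suc k ∎
  where
  p = Pℤ k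
  q = Qℤ k
  step : ∀ p q → (+ 2 * p + q) * (+ 2 * p + q) - + 2 * ((p + q) * (p + q)) ≡
                 -1ℤ * (q * q - + 2 * (p * p))
  step = solve-∀

-1^even : ∀ m → -1ℤ ^ (m ℕ.* 2) ≡ 1ℤ
-1^even zero    = refl
-1^even (suc m) = begin
  -1ℤ * (-1ℤ * -1ℤ ^ (m ℕ.* 2)) ≡⟨ -1*i≡-i _ ⟩
  - (-1ℤ * -1ℤ ^ (m ℕ.* 2))      ≡⟨ cong -_ (-1*i≡-i _) ⟩
  - - -1ℤ ^ (m ℕ.* 2)            ≡⟨ neg-involutive _ ⟩
  -1ℤ ^ (m ℕ.* 2)                ≡⟨ -1^even m ⟩
  1ℤ                             ∎

c-Pell-form : ∀ k → c k ≡ + 4 * Pℤ k * Qℤ k - Qℤ k * Qℤ k - + 2 * (Pℤ k * Pℤ k)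
                  × c (suc k) ≡ + 2 * (Pℤ k * Pℤ k) + + 4 * Pℤ k * Qℤ k + Qℤ k * Qℤ k
c-Pell-form zero    = refl , refl
c-Pell-form (suc k) = c-suc , c-suc-suc
  where
  p = Pℤ k
  q = Qℤ k
  c-suc : c (suc k) ≡
          + 4 * Pℤ (suc k) * Qℤ (suc k) - Qℤ (suc k) * Qℤ (suc k) - + 2 * (Pℤ (suc k) * Pℤ (suc k))
  c-suc = begin
    c (suc k)                           ≡⟨ proj₂ (c-Pell-form k) ⟩
    + 2 * (p * p) + + 4 * p * q + q * q ≡⟨ shift p q ⟩
    + 4 * (p + q) * (+ 2 * p + q) - (+ 2 * p + q) * (+ 2 * p + q) - + 2 * ((p + q) * (p + q))
      ≡⟨ PQ-suc (λ p q → + 4 * p * q - q * q - + 2 * (p * p)) k ⟨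
    + 4 * Pℤ (suc k) * Qℤ (suc k) - Qℤ (suc k) * Qℤ (suc k) - + 2 * (Pℤ (suc k) * Pℤ (suc k)) ∎
    where
    shift : ∀ p q → + 2 * (p * p) + + 4 * p * q + q * q ≡
      + 4 * (p + q) * (+ 2 * p + q) - (+ 2 * p + q) * (+ 2 * p + q) - + 2 * ((p + q) * (p + q))
    shift = solve-∀
  c-suc-suc : c (suc (suc k)) ≡
              + 2 * (Pℤ (suc k) * Pℤ (suc k)) + + 4 * Pℤ (suc k) * Qℤ (suc k) + Qℤ (suc k) * Qℤ (suc k)
  c-suc-suc = begin
    + 6 * c (suc k) - c k
      ≡⟨ cong₂ (λ u v → + 6 * u - v) (proj₂ (c-Pell-form k)) (proj₁ (c-Pell-form k)) ⟩
    + 6 * (+ 2 * (p * p) + + 4 * p * q + q * q) - (+ 4 * p * q - q * q - + 2 * (p * p))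
      ≡⟨ recurrence p q ⟩
    + 2 * ((p + q) * (p + q)) + + 4 * (p + q) * (+ 2 * p + q) + (+ 2 * p + q) * (+ 2 * p + q)
      ≡⟨ PQ-suc (λ p q → + 2 * (p * p) + + 4 * p * q + q * q) k ⟨
    + 2 * (Pℤ (suc k) * Pℤ (suc k)) + + 4 * Pℤ (suc k) * Qℤ (suc k) + Qℤ (suc k) * Qℤ (suc k) ∎
    where
    recurrence : ∀ p q →
      + 6 * (+ 2 * (p * p) + + 4 * p * q + q * q) - (+ 4 * p * q - q * q - + 2 * (p * p)) ≡
      + 2 * ((p + q) * (p + q)) + + 4 * (p + q) * (+ 2 * p + q) + (+ 2 * p + q) * (+ 2 * p + q)
    recurrence = solve-∀

sumC-0-closed : ∀ k → + 2 * sumC 0 k + 1ℤ ≡ Qℤ k * Qℤ k + + 2 * (Pℤ k * Pℤ k)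
sumC-0-closed zero    = refl
sumC-0-closed (suc k) = begin
  + 2 * (sumC 0 k + c (suc k)) + 1ℤ
    ≡⟨ distrib (sumC 0 k) (c (suc k)) ⟩
  (+ 2 * sumC 0 k + 1ℤ) + + 2 * c (suc k)
    ≡⟨ cong₂ (λ u v → u + + 2 * v) (sumC-0-closed k) (proj₂ (c-Pell-form k)) ⟩
  (q * q + + 2 * (p * p)) + + 2 * (+ 2 * (p * p) + + 4 * p * q + q * q)
    ≡⟨ step p q ⟩
  (+ 2 * p + q) * (+ 2 * p + q) + + 2 * ((p + q) * (p + q))
    ≡⟨ PQ-suc (λ p q → q * q + + 2 * (p * p)) k ⟨
  Qℤ (suc k) * Qℤ (suc k) + + 2 * (Pℤ (suc k) * Pℤ (suc k)) ∎
  where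
  p = Pℤ k
  q = Qℤ k
  distrib : ∀ s t → + 2 * (s + t) + 1ℤ ≡ (+ 2 * s + 1ℤ) + + 2 * t
  distrib = solve-∀
  step : ∀ p q → (q * q + + 2 * (p * p)) + + 2 * (+ 2 * (p * p) + + 4 * p * q + q * q) ≡
                 (+ 2 * p + q) * (+ 2 * p + q) + + 2 * ((p + q) * (p + q))
  step = solve-∀

sumC-1-shift : ∀ k → 1ℤ + sumC 1 k ≡ sumC 0 (suc k)
sumC-1-shift zero    = refl
sumC-1-shift (suc k) = trans (sym (+-assoc 1ℤ (sumC 1 k) (c (suc (suc k)))))
                         (cong (_+ c (suc (suc k))) (sumC-1-shift k))

sumC-1-closed : ∀ k → + 2 * sumC 1 k + + 3 ≡
  (+ 2 * Pℤ k + Qℤ k) * (+ 2 * Pℤ k + Qℤ k) + + 2 * ((Pℤ k + Qℤ k) * (Pℤ k + Qℤ k))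
sumC-1-closed k = begin
  + 2 * sumC 1 k + + 3                 ≡⟨ shift (sumC 1 k) ⟩
  + 2 * (1ℤ + sumC 1 k) + 1ℤ           ≡⟨ cong (λ s → + 2 * s + 1ℤ) (sumC-1-shift k) ⟩
  + 2 * sumC 0 (suc k) + 1ℤ            ≡⟨ sumC-0-closed (suc k) ⟩
  Qℤ (suc k) * Qℤ (suc k) + + 2 * (Pℤ (suc k) * Pℤ (suc k))
    ≡⟨ PQ-suc (λ p q → q * q + + 2 * (p * p)) k ⟩
  (+ 2 * Pℤ k + Qℤ k) * (+ 2 * Pℤ k + Qℤ k) + + 2 * ((Pℤ k + Qℤ k) * (Pℤ k + Qℤ k)) ∎
  where
  shift : ∀ s → + 2 * s + + 3 ≡ + 2 * (1ℤ + s) + 1ℤ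
  shift = solve-∀

2*-+-cancel : ∀ {s t} e → + 2 * s + e ≡ + 2 * t + e → s ≡ t
2*-+-cancel {s} {t} e eq = *-cancelˡ-≡ (+ 2) s t (begin
  + 2 * s         ≡⟨ solve (s ∷ e ∷ []) ⟩
  + 2 * s + e - e ≡⟨ cong (_- e) eq ⟩
  + 2 * t + e - e ≡⟨ solve (t ∷ e ∷ []) ⟩
  + 2 * t         ∎)

even-certificate : ∀ {s₀ s₁} p q r → p ≡ r * + 2 → q * q - + 2 * (p * p) ≡ 1ℤ →
  + 2 * s₀ + 1ℤ ≡ q * q + + 2 * (p * p) →
  + 2 * s₁ + + 3 ≡ (+ 2 * p + q) * (+ 2 * p + q) + + 2 * ((p + q) * (p + q)) →
  GCDCertificate s₀ s₁ (+ 4 * p)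
even-certificate {s₀} {s₁} _ q r refl pell h₀ h₁ = record
  { x      = r
  ; y      = + 3 * r + q
  ; α      = - (+ 8 * r + + 3 * q)
  ; β      = q
  ; m≡x*d  = 2*-+-cancel 1ℤ (begin
      + 2 * s₀ + 1ℤ
        ≡⟨ h₀ ⟩
      q * q + + 2 * (r * + 2 * (r * + 2))
        ≡⟨ solve (q ∷ r ∷ []) ⟩
      + 2 * (r * (+ 4 * (r * + 2))) + (q * q - + 2 * (r * + 2 * (r * + 2)))
        ≡⟨ cong (λ e → + 2 * (r * (+ 4 * (r * + 2))) + e) pell ⟩
      + 2 * (r * (+ 4 * (r * + 2))) + 1ℤ ∎)
  ; n≡y*d  = 2*-+-cancel (+ 3) (begin
      + 2 * s₁ + + 3
        ≡⟨ h₁ ⟩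
      (+ 2 * (r * + 2) + q) * (+ 2 * (r * + 2) + q) + + 2 * ((r * + 2 + q) * (r * + 2 + q))
        ≡⟨ solve (q ∷ r ∷ []) ⟩
      + 2 * ((+ 3 * r + q) * (+ 4 * (r * + 2))) + + 3 * (q * q - + 2 * (r * + 2 * (r * + 2)))
        ≡⟨ cong (λ e → + 2 * ((+ 3 * r + q) * (+ 4 * (r * + 2))) + + 3 * e) pell ⟩
      + 2 * ((+ 3 * r + q) * (+ 4 * (r * + 2))) + + 3 ∎)
  ; bézout = begin
      - (+ 8 * r + + 3 * q) * r + q * (+ 3 * r + q) ≡⟨ solve (q ∷ r ∷ []) ⟩
      q * q - + 2 * (r * + 2 * (r * + 2))           ≡⟨ pell ⟩
      1ℤ                                            ∎
  }

odd-certificate : ∀ {s₀ s₁} p q → q * q - + 2 * (p * p) ≡ -1ℤ →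
  + 2 * s₀ + 1ℤ ≡ q * q + + 2 * (p * p) →
  + 2 * s₁ + + 3 ≡ (+ 2 * p + q) * (+ 2 * p + q) + + 2 * ((p + q) * (p + q)) →
  GCDCertificate s₀ s₁ q
odd-certificate {s₀} {s₁} p q pell h₀ h₁ = record
  { x      = q
  ; y      = + 3 * q + + 4 * p
  ; α      = q * q * q - + 4 * (p * p) * q - + 3 * (p * p * p)
  ; β      = p * p * p
  ; m≡x*d  = 2*-+-cancel 1ℤ (begin
      + 2 * s₀ + 1ℤ                                   ≡⟨ h₀ ⟩
      q * q + + 2 * (p * p)                           ≡⟨ solve (p ∷ q ∷ []) ⟩
      + 2 * (q * q) - (q * q - + 2 * (p * p))         ≡⟨ cong (λ e → + 2 * (q * q) - e) pell ⟩
      + 2 * (q * q) + 1ℤ                              ∎)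
  ; n≡y*d  = 2*-+-cancel (+ 3) (begin
      + 2 * s₁ + + 3
        ≡⟨ h₁ ⟩
      (+ 2 * p + q) * (+ 2 * p + q) + + 2 * ((p + q) * (p + q))
        ≡⟨ solve (p ∷ q ∷ []) ⟩
      + 2 * ((+ 3 * q + + 4 * p) * q) - + 3 * (q * q - + 2 * (p * p))
        ≡⟨ cong (λ e → + 2 * ((+ 3 * q + + 4 * p) * q) - + 3 * e) pell ⟩
      + 2 * ((+ 3 * q + + 4 * p) * q) + + 3 ∎)
  -- (q² − 2p²)² = 1 is itself a Bézout identity between q and 3q + 4p.
  ; bézout = begin
      (q * q * q - + 4 * (p * p) * q - + 3 * (p * p * p)) * q + p * p * p * (+ 3 * q + + 4 * p)
        ≡⟨ solve (p ∷ q ∷ []) ⟩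
      (q * q - + 2 * (p * p)) * (q * q - + 2 * (p * p))
        ≡⟨ cong (λ e → e * e) pell ⟩
      1ℤ ∎
  }

cGCD-even : ∀ {k} → 2 ∣ k → cGCD k (4 ℕ.* P k)
cGCD-even (divides m refl) with P-even m
... | divides r P≡r*2 = Recurrence-IsGCDOf {λ n → sumC n k} (sumC-recurrence k)
  (subst (GCDCertificate (sumC 0 k) (sumC 1 k)) (sym (pos-* 4 (P k)))
    (even-certificate (Pℤ k) (Qℤ k) (+ r) (trans (cong +_ P≡r*2) (pos-* r 2))
                      (trans (Pell-equation k) (-1^even m))
                      (sumC-0-closed k) (sumC-1-closed k)))
  where
  k = m ℕ.* 2

even-or-odd : ∀ k → 2 ∣ k ⊎ ∃[ m ] k ≡ suc (m ℕ.* 2)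
even-or-odd zero    = inj₁ (divides 0 refl)
even-or-odd (suc k) with even-or-odd k
... | inj₁ (divides m k≡m*2) = inj₂ (m , cong suc k≡m*2)
... | inj₂ (m , k≡1+m*2)     = inj₁ (divides (suc m) (cong suc k≡1+m*2))

cGCD-odd : ∀ {k} → 2 ∤ k → cGCD k (Q k)
cGCD-odd {k} 2∤k with even-or-odd k
... | inj₁ 2∣k          = contradiction 2∣k 2∤k
... | inj₂ (m , refl)   = Recurrence-IsGCDOf {λ n → sumC n k′} (sumC-recurrence k′)
  (odd-certificate (Pℤ k′) (Qℤ k′) (trans (Pell-equation k′) (cong (-1ℤ *_) (-1^even m)))
                   (sumC-0-closed k′) (sumC-1-closed k′))
  where
  k′ = suc (m ℕ.* 2)

theorem19 : ∀ (k : ℕ) → k ≥ 1 →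
              (2 ∣ k → cGCD k (4 ℕ.* P k)) × (2 ∤ k → cGCD k (Q k))
theorem19 k _ = cGCD-even , cGCD-odd
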